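{- Let $\mathcal S$ be one of the four step sets simple, diagonal, king, diabolo (listed in the context), and let $(a,b)\in\mathcal C$ be a starting point. For every $(i,j)\in\mathcal Q$, \[ C^{a,b}_{i,j}=C^{a,b}_{ -i-2,j}+C^{a,b}_{i,-j-2}+\begin{cases}Q^{a,b}_{i,j}&\text{if }a,b\ge0,\\ 0&\text{if }a=-1\text{ or }b=-1,\\ -Q^{ -a-2,b}_{i,j}&\text{if }a<-1,\\ -Q^{a,-b-2}_{i,j}&\text{if }b<-1.\end{cases} \] Furthermore, each of these identities can be proved by an explicit bijection.
   Context: The four step sets are: simple $\{(1,0),(0,1),(-1,0),(0,-1)\}$; diagonal $\{(1,1),(-1,1),(-1,-1),(1,-1)\}$; king $\{ -1,0,1\}^2\setminus\{(0,0)\}$; diabolo $\{(1,0),(1,1),(-1,1),(-1,0),(-1,-1),(1,-1)\}$. $\mathcal Q=\{(i,j):i\ge0,j\ge0\}$, $\mathcal C=\{(i,j)\in\mathbb Z^2:i\ge0\text{ or }j\ge0\}$. A walk is confined to $\mathcal C$ if all its vertices lie in $\mathcal C$ and it uses no step between $(-1,0)$ and $(0,-1)$. $C^{a,b}_{i,j}\in\mathbb Q[[t]]$ is the length generating function of walks with steps in $\mathcal S$ from $(a,b)$ to $(i,j)$ confined to $\mathcal C$, and $Q^{a,b}_{i,j}$ that of walks from $(a,b)$ to $(i,j)$ with all vertices in $\mathcal Q$. -}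

module Defs where

open import Data.Bool using (Bool; true; false; _∧_; _∨_; not)
open import Data.Nat using (ℕ; zero; suc)
open import Data.Integer using (ℤ; +_; -[1+_]; _≤ᵇ_) renaming (_+_ to _+ℤ_)
import Data.Integer.Properties as ℤP
open import Data.Product using (_×_; _,_)
open import Data.List using (List; []; _∷_; map; concatMap)
open import Relation.Nullary.Decidable using (⌊_⌋)

Point : Set
Point = ℤ × ℤ

_⊕_ : Point → Point → Point
(x , y) ⊕ (u , v) = (x +ℤ u , y +ℤ v)

_==_ : Point → Point → Bool
(x , y) == (u , v) = ⌊ x ℤP.≟ u ⌋ ∧ ⌊ y ℤP.≟ v ⌋

data StepSet : Set where
  simple diagonal king diabolo : StepSet

-1ℤ : ℤ
-1ℤ = -[1+ 0 ]

0ℤ 1ℤ : ℤ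
0ℤ = + 0
1ℤ = + 1

steps : StepSet → List Point
steps simple   = (1ℤ , 0ℤ) ∷ (0ℤ , 1ℤ) ∷ (-1ℤ , 0ℤ) ∷ (0ℤ , -1ℤ) ∷ []
steps diagonal = (1ℤ , 1ℤ) ∷ (-1ℤ , 1ℤ) ∷ (-1ℤ , -1ℤ) ∷ (1ℤ , -1ℤ) ∷ []
steps king     = (1ℤ , 0ℤ) ∷ (1ℤ , 1ℤ) ∷ (0ℤ , 1ℤ) ∷ (-1ℤ , 1ℤ)
               ∷ (-1ℤ , 0ℤ) ∷ (-1ℤ , -1ℤ) ∷ (0ℤ , -1ℤ) ∷ (1ℤ , -1ℤ) ∷ []
steps diabolo  = (1ℤ , 0ℤ) ∷ (1ℤ , 1ℤ) ∷ (-1ℤ , 1ℤ) ∷ (-1ℤ , 0ℤ)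
               ∷ (-1ℤ , -1ℤ) ∷ (1ℤ , -1ℤ) ∷ []

inQ : Point → Bool
inQ (i , j) = (0ℤ ≤ᵇ i) ∧ (0ℤ ≤ᵇ j)

inC : Point → Bool
inC (i , j) = (0ℤ ≤ᵇ i) ∨ (0ℤ ≤ᵇ j)

forbidden : Point → Point → Bool
forbidden p p' = ((p == (-1ℤ , 0ℤ)) ∧ (p' == (0ℤ , -1ℤ)))
               ∨ ((p == (0ℤ , -1ℤ)) ∧ (p' == (-1ℤ , 0ℤ)))

sequences : List Point → ℕ → List (List Point)
sequences S zero    = [] ∷ []
sequences S (suc n) = concatMap (λ s → map (s ∷_) (sequences S n)) S

walkC : Point → List Point → Point → Bool
walkC p []      q = inC p ∧ (p == q)
walkC p (s ∷ w) q = inC p ∧ not (forbidden p (p ⊕ s)) ∧ walkC (p ⊕ s) w q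

walkQ : Point → List Point → Point → Bool
walkQ p []      q = inQ p ∧ (p == q)
walkQ p (s ∷ w) q = inQ p ∧ walkQ (p ⊕ s) w q

count : {A : Set} → (A → Bool) → List A → ℕ
count f []       = 0
count f (x ∷ xs) with f x
... | true  = suc (count f xs)
... | false = count f xs

-- Coefficient of t^n in C^{a,b}_{i,j} (for the step set S)
Ccoeff : StepSet → ℕ → (a b : ℤ) → (i j : ℤ) → ℕ
Ccoeff S n a b i j = count (λ w → walkC (a , b) w (i , j)) (sequences (steps S) n)

-- Coefficient of t^n in Q^{a,b}_{i,j} (for the step set S)
Qcoeff : StepSet → ℕ → (a b : ℤ) → (i j : ℤ) → ℕ
Qcoeff S n a b i j = count (λ w → walkQ (a , b) w (i , j)) (sequences (steps S) n)

-- A walk confined to the cone C is counted by the same first-step recurrence as a quadrant walk,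
-- except that the steps between (-1,0) and (0,-1) are forbidden and the start must lie in C.
-- Write σx, σy for the reflections in the lines x = -1 and y = -1. For a function f supported
-- in Q, the alternating sum f − f∘σx − f∘σy satisfies the recurrence of the cone: the step sets
-- are invariant under both axis reflections, this sum vanishes on the lines x = -1 and y = -1
-- (so the forbidden steps do not matter), and outside Q at most one of the three terms survives.
-- Hence, by induction on the length, the number of cone walks from p to t ∈ Q equals the number
-- of cone walks to σx t and to σy t plus the alternating sum of quadrant walk counts to t,
-- evaluated at p; the four cases of the theorem read off which quadrant terms vanish at p.
module Submission where

open import Defs
open import Data.Bool using (Bool; true; false; _∧_; not)
open import Data.Bool.Properties using (∧-zeroʳ; ∨-zeroʳ)
open import Data.Integer using (ℤ; +_; -[1+_]; _+_; _-_; -_; _≤_; _<_; -<-; -<+; +≤+)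
import Data.Integer.Properties as ℤ
open import Algebra.Properties.CommutativeSemigroup ℤ.+-commutativeSemigroup using (interchange; x∙yz≈y∙xz)
open import Data.Integer.Tactic.RingSolver using (solve-∀)
open import Data.List using (List; []; _∷_; map; concatMap; _++_)
open import Data.List.Relation.Unary.All as All using (All; []; _∷_)
open import Data.List.Relation.Binary.Permutation.Propositional as ↭
  using (_↭_; ↭-refl; ↭-prep; ↭-swap; ↭-trans; ↭-sym)
import Data.Maybe as Maybe
open import Data.Maybe using (Maybe; just; nothing; from-just)
open import Data.Nat using (ℕ; zero; suc; z≤n; s≤s) renaming (_+_ to _+ℕ_)
open import Data.Product using (_×_; _,_; ∃; uncurry)
open import Data.Product.Properties using (,-injective)
open import Data.Sum using (_⊎_; inj₁; inj₂) renaming (map to ⊎-map)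
open import Relation.Binary.Definitions using (DecidableEquality)
open import Relation.Binary.PropositionalEquality
open import Relation.Nullary.Decidable using (Dec; yes; no; proof; map′; _×-dec_; from-yes; isYes≗does)
open import Relation.Nullary.Reflects using (Reflects; ofʸ; ofⁿ; det)

∑ : {A : Set} → List A → (A → ℤ) → ℤ
∑ []       g = 0ℤ
∑ (x ∷ xs) g = g x + ∑ xs g

module _ {A : Set} where

  ∑-cong : ∀ xs {g h : A → ℤ} → (∀ x → g x ≡ h x) → ∑ xs g ≡ ∑ xs h
  ∑-cong []       g≗h = refl
  ∑-cong (x ∷ xs) g≗h = cong₂ _+_ (g≗h x) (∑-cong xs g≗h)

  ∑-+ : ∀ xs (g h : A → ℤ) → ∑ xs (λ x → g x + h x) ≡ ∑ xs g + ∑ xs h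
  ∑-+ []       g h = refl
  ∑-+ (x ∷ xs) g h = trans (cong (_+_ (g x + h x)) (∑-+ xs g h)) (interchange (g x) (h x) (∑ xs g) (∑ xs h))

  ∑-neg : ∀ xs (g : A → ℤ) → ∑ xs (λ x → - g x) ≡ - ∑ xs g
  ∑-neg []       g = refl
  ∑-neg (x ∷ xs) g = trans (cong (_+_ (- g x)) (∑-neg xs g)) (sym (ℤ.neg-distrib-+ (g x) (∑ xs g)))

  ∑-- : ∀ xs (g h : A → ℤ) → ∑ xs (λ x → g x - h x) ≡ ∑ xs g - ∑ xs h
  ∑-- xs g h = trans (∑-+ xs g (λ x → - h x)) (cong (_+_ (∑ xs g)) (∑-neg xs h))

  ∑-zero : ∀ xs (g : A → ℤ) → All (λ x → g x ≡ 0ℤ) xs → ∑ xs g ≡ 0ℤ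
  ∑-zero []       g []         = refl
  ∑-zero (x ∷ xs) g (gx≡0 ∷ z) = cong₂ _+_ gx≡0 (∑-zero xs g z)

  ∑-map : ∀ {B : Set} (r : B → A) xs (g : A → ℤ) → ∑ (map r xs) g ≡ ∑ xs (λ x → g (r x))
  ∑-map r []       g = refl
  ∑-map r (x ∷ xs) g = cong (_+_ (g (r x))) (∑-map r xs g)

  ∑-↭ : ∀ {xs ys} (g : A → ℤ) → xs ↭ ys → ∑ xs g ≡ ∑ ys g
  ∑-↭ g ↭.refl                 = refl
  ∑-↭ g (↭.prep x xs↭ys)       = cong (_+_ (g x)) (∑-↭ g xs↭ys)
  ∑-↭ g (↭.swap x y xs↭ys)     = trans (cong (λ s → g x + (g y + s)) (∑-↭ g xs↭ys)) (x∙yz≈y∙xz (g x) (g y) _)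
  ∑-↭ g (↭.trans xs↭ys ys↭zs) = trans (∑-↭ g xs↭ys) (∑-↭ g ys↭zs)

module _ {A : Set} (_≟_ : DecidableEquality A) where

  extract : (x : A) (ys : List A) → Maybe (∃ λ zs → ys ↭ x ∷ zs)
  extract x []       = nothing
  extract x (y ∷ ys) with x ≟ y
  ... | yes refl = just (ys , ↭-refl)
  ... | no _     = Maybe.map (λ (zs , ys↭x∷zs) → y ∷ zs , ↭-trans (↭-prep y ys↭x∷zs) (↭-swap y x ↭-refl))
                             (extract x ys)

  findPermutation : (xs ys : List A) → Maybe (xs ↭ ys)
  findPermutation []       []      = just ↭-refl
  findPermutation []       (_ ∷ _) = nothing
  findPermutation (x ∷ xs) ys with extract x ys
  ... | nothing              = nothing
  ... | just (zs , ys↭x∷zs) =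
    Maybe.map (λ xs↭zs → ↭-trans (↭-prep x xs↭zs) (↭-sym ys↭x∷zs)) (findPermutation xs zs)

_≟ₚ_ : DecidableEquality Point
(x , y) ≟ₚ (u , v) = map′ (uncurry (cong₂ _,_)) ,-injective (x ℤ.≟ u ×-dec y ℤ.≟ v)

==-reflects : ∀ p q → Reflects (p ≡ q) (p == q)
==-reflects (x , y) (u , v) =
  subst (Reflects _) (sym (cong₂ _∧_ (isYes≗does (x ℤ.≟ u)) (isYes≗does (y ℤ.≟ v)))) (proof ((x , y) ≟ₚ (u , v)))

reflects-map : ∀ {A B : Set} {b} → (A → B) → (B → A) → Reflects A b → Reflects B b
reflects-map to from (ofʸ a)  = ofʸ (to a)
reflects-map to from (ofⁿ ¬a) = ofⁿ (λ b → ¬a (from b))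

==-involution : (ι : Point → Point) → (∀ p → ι (ι p) ≡ p) → ∀ p q → (ι p == q) ≡ (p == ι q)
==-involution ι ι∘ι≗id p q = det (==-reflects (ι p) q) (reflects-map to from (==-reflects p (ι q)))
  where
  to : p ≡ ι q → ι p ≡ q
  to p≡ιq = trans (cong ι p≡ιq) (ι∘ι≗id q)
  from : ι p ≡ q → p ≡ ι q
  from ιp≡q = trans (sym (ι∘ι≗id p)) (cong ι ιp≡q)

∧-== : (P : Point → Bool) → ∀ p q → P q ≡ true → (P p ∧ (p == q)) ≡ (p == q)
∧-== P p q Pq with p == q | ==-reflects p q
... | true  | ofʸ refl = cong (_∧ true) Pq
... | false | ofⁿ _    = ∧-zeroʳ (P p)

reflectX reflectY : Point → Point
reflectX (x , y) = (- x - + 2 , y)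
reflectY (x , y) = (x , - y - + 2)

negX negY : Point → Point
negX (x , y) = (- x , y)
negY (x , y) = (x , - y)

private
  -[-x-c]-c≡x : ∀ x c → - (- x - c) - c ≡ x
  -[-x-c]-c≡x = solve-∀

  -[x+a]-c≡-x-c-a : ∀ x a c → - (x + a) - c ≡ (- x - c) + - a
  -[x+a]-c≡-x-c-a = solve-∀

reflectX-involutive : ∀ p → reflectX (reflectX p) ≡ p
reflectX-involutive (x , y) = cong (_, y) (-[-x-c]-c≡x x (+ 2))

reflectY-involutive : ∀ p → reflectY (reflectY p) ≡ p
reflectY-involutive (x , y) = cong (x ,_) (-[-x-c]-c≡x y (+ 2))

reflectX-⊕ : ∀ p s → reflectX (p ⊕ s) ≡ reflectX p ⊕ negX s
reflectX-⊕ (x , y) (a , b) = cong (_, y + b) (-[x+a]-c≡-x-c-a x a (+ 2))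

reflectY-⊕ : ∀ p s → reflectY (p ⊕ s) ≡ reflectY p ⊕ negY s
reflectY-⊕ (x , y) (a , b) = cong (x + a ,_) (-[x+a]-c≡-x-c-a y b (+ 2))

reflect-<-1 : ∀ m → - (+ m) - + 2 < -1ℤ
reflect-<-1 zero    = -<- (s≤s z≤n)
reflect-<-1 (suc m) = -<- (s≤s z≤n)

<-1⇒<0 : ∀ {x} → x < -1ℤ → x < 0ℤ
<-1⇒<0 (-<- _) = -<+

inQ-outside : ∀ {x y} → x < 0ℤ ⊎ y < 0ℤ → inQ (x , y) ≡ false
inQ-outside (inj₁ -<+) = refl
inQ-outside (inj₂ -<+) = ∧-zeroʳ _

-- Counting walks by their first step

guard : Bool → ℤ → ℤ
guard true  x = x
guard false _ = 0ℤ

guard-+ : ∀ b x y → guard b (x + y) ≡ guard b x + guard b y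
guard-+ true  x y = refl
guard-+ false x y = refl

guard-zero : ∀ b → guard b 0ℤ ≡ 0ℤ
guard-zero true  = refl
guard-zero false = refl

∑-guard : ∀ {A : Set} xs b (g : A → ℤ) → ∑ xs (λ x → guard b (g x)) ≡ guard b (∑ xs g)
∑-guard xs true  g = refl
∑-guard xs false g = ∑-zero xs _ (All.universal (λ _ → refl) xs)

module _ {A : Set} (P : A → Bool) where

  count-++ : ∀ xs ys → count P (xs ++ ys) ≡ count P xs +ℕ count P ys
  count-++ []       ys = refl
  count-++ (x ∷ xs) ys with P x
  ... | true  = cong suc (count-++ xs ys)
  ... | false = count-++ xs ys

  count-map : ∀ {B : Set} (f : B → A) xs → count P (map f xs) ≡ count (λ x → P (f x)) xs
  count-map f []       = refl
  count-map f (x ∷ xs) with P (f x)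
  ... | true  = cong suc (count-map f xs)
  ... | false = count-map f xs

  count-singleton : ∀ x → + count P (x ∷ []) ≡ guard (P x) 1ℤ
  count-singleton x with P x
  ... | true  = refl
  ... | false = refl

count-∧ : ∀ {A : Set} b (P : A → Bool) xs → + count (λ x → b ∧ P x) xs ≡ guard b (+ count P xs)
count-∧ true  P xs       = refl
count-∧ false P []       = refl
count-∧ false P (x ∷ xs) = count-∧ false P xs

count-none : ∀ {A : Set} (P : A → Bool) → (∀ x → P x ≡ false) → ∀ xs → count P xs ≡ 0
count-none P none []       = refl
count-none P none (x ∷ xs) rewrite none x = count-none P none xs

count-prepend : ∀ {A : Set} (P : List A → Bool) (ws : List (List A)) xs →
  + count P (concatMap (λ s → map (s ∷_) ws) xs) ≡ ∑ xs (λ s → + count (λ w → P (s ∷ w)) ws)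
count-prepend P ws []       = refl
count-prepend P ws (s ∷ xs) = begin
  + count P (map (s ∷_) ws ++ concatMap (λ s → map (s ∷_) ws) xs)
    ≡⟨ cong +_ (count-++ P (map (s ∷_) ws) _) ⟩
  + count P (map (s ∷_) ws) + + count P (concatMap (λ s → map (s ∷_) ws) xs)
    ≡⟨ cong₂ _+_ (cong +_ (count-map P (s ∷_) ws)) (count-prepend P ws xs) ⟩
  ∑ (s ∷ xs) (λ s → + count (λ w → P (s ∷ w)) ws) ∎
  where open ≡-Reasoning

walksC walksQ : List Point → ℕ → Point → Point → ℤ
walksC L n p q = + count (λ w → walkC p w q) (sequences L n)
walksQ L n p q = + count (λ w → walkQ p w q) (sequences L n)

neighbourSum : List Point → (Point → ℤ) → Point → ℤ
neighbourSum L f p = ∑ L (λ s → f (p ⊕ s))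

transferC transferQ : List Point → (Point → ℤ) → Point → ℤ
transferC L f p = guard (inC p) (∑ L (λ s → guard (not (forbidden p (p ⊕ s))) (f (p ⊕ s))))
transferQ L f p = guard (inQ p) (neighbourSum L f p)

walksC-zero : ∀ L p q → inC q ≡ true → walksC L 0 p q ≡ guard (p == q) 1ℤ
walksC-zero L p q q∈C =
  trans (count-singleton (λ w → walkC p w q) []) (cong (λ b → guard b 1ℤ) (∧-== inC p q q∈C))

walksQ-zero : ∀ L p q → inQ q ≡ true → walksQ L 0 p q ≡ guard (p == q) 1ℤ
walksQ-zero L p q q∈Q =
  trans (count-singleton (λ w → walkQ p w q) []) (cong (λ b → guard b 1ℤ) (∧-== inQ p q q∈Q))

walksC-suc : ∀ L n p q → walksC L (suc n) p q ≡ transferC L (λ r → walksC L n r q) p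
walksC-suc L n p q = begin
  walksC L (suc n) p q
    ≡⟨ count-prepend (λ w → walkC p w q) (sequences L n) L ⟩
  ∑ L (λ s → + count (λ w → inC p ∧ (allowed s ∧ walkC (p ⊕ s) w q)) (sequences L n))
    ≡⟨ ∑-cong L (λ s → trans (count-∧ (inC p) _ (sequences L n))
                              (cong (guard (inC p)) (count-∧ (allowed s) _ (sequences L n)))) ⟩
  ∑ L (λ s → guard (inC p) (guard (allowed s) (walksC L n (p ⊕ s) q)))
    ≡⟨ ∑-guard L (inC p) _ ⟩
  transferC L (λ r → walksC L n r q) p ∎
  where
  open ≡-Reasoning
  allowed : Point → Bool
  allowed s = not (forbidden p (p ⊕ s))

walksQ-suc : ∀ L n p q → walksQ L (suc n) p q ≡ transferQ L (λ r → walksQ L n r q) p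
walksQ-suc L n p q = begin
  walksQ L (suc n) p q
    ≡⟨ count-prepend (λ w → walkQ p w q) (sequences L n) L ⟩
  ∑ L (λ s → + count (λ w → inQ p ∧ walkQ (p ⊕ s) w q) (sequences L n))
    ≡⟨ ∑-cong L (λ s → count-∧ (inQ p) _ (sequences L n)) ⟩
  ∑ L (λ s → guard (inQ p) (walksQ L n (p ⊕ s) q))
    ≡⟨ ∑-guard L (inQ p) _ ⟩
  transferQ L (λ r → walksQ L n r q) p ∎
  where open ≡-Reasoning

-- The reflection identity

VanishesBelow : ℤ → (Point → ℤ) → Set
VanishesBelow m f = ∀ x y → x < m ⊎ y < m → f (x , y) ≡ 0ℤ

SmallStep : Point → Set
SmallStep (a , b) = a ≤ 1ℤ × b ≤ 1ℤ

AxisSymmetric : List Point → Set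
AxisSymmetric L = map negX L ↭ L × map negY L ↭ L

walksQ-vanishesBelow : ∀ L n q → VanishesBelow 0ℤ (λ r → walksQ L n r q)
walksQ-vanishesBelow L n q x y out = cong +_ (count-none _ walkQ-outside (sequences L n))
  where
  walkQ-outside : ∀ w → walkQ (x , y) w q ≡ false
  walkQ-outside []      rewrite inQ-outside out = refl
  walkQ-outside (_ ∷ _) rewrite inQ-outside out = refl

neighbourSum-vanishesBelow : ∀ {L m f} → All SmallStep L → VanishesBelow (m + 1ℤ) f →
  VanishesBelow m (neighbourSum L f)
neighbourSum-vanishesBelow {L} {m} {f} small f-vanishes x y out = ∑-zero L _ (All.map shifted small)
  where
  shifted : ∀ {s} → SmallStep s → f ((x , y) ⊕ s) ≡ 0ℤ
  shifted {a , b} (a≤1 , b≤1) =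
    f-vanishes (x + a) (y + b) (⊎-map (λ x<m → ℤ.+-mono-<-≤ x<m a≤1) (λ y<m → ℤ.+-mono-<-≤ y<m b≤1) out)

transferC-cong : ∀ L {f g} → (∀ r → f r ≡ g r) → ∀ p → transferC L f p ≡ transferC L g p
transferC-cong L f≗g p = cong (guard (inC p)) (∑-cong L (λ s → cong (guard _) (f≗g (p ⊕ s))))

transferC-+ : ∀ L f g p → transferC L (λ r → f r + g r) p ≡ transferC L f p + transferC L g p
transferC-+ L f g p = begin
  guard (inC p) (∑ L (λ s → allowed s (f (p ⊕ s) + g (p ⊕ s))))
    ≡⟨ cong (guard (inC p)) (∑-cong L (λ s → guard-+ _ (f (p ⊕ s)) (g (p ⊕ s)))) ⟩
  guard (inC p) (∑ L (λ s → allowed s (f (p ⊕ s)) + allowed s (g (p ⊕ s))))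
    ≡⟨ cong (guard (inC p)) (∑-+ L _ _) ⟩
  guard (inC p) (∑ L (λ s → allowed s (f (p ⊕ s))) + ∑ L (λ s → allowed s (g (p ⊕ s))))
    ≡⟨ guard-+ (inC p) _ _ ⟩
  transferC L f p + transferC L g p ∎
  where
  open ≡-Reasoning
  allowed : Point → ℤ → ℤ
  allowed s = guard (not (forbidden p (p ⊕ s)))

alternate : (Point → ℤ) → Point → ℤ
alternate f p = f p - f (reflectX p) - f (reflectY p)

alternate-cong : ∀ {f g} → (∀ r → f r ≡ g r) → ∀ p → alternate f p ≡ alternate g p
alternate-cong f≗g p = cong₂ _-_ (cong₂ _-_ (f≗g p) (f≗g (reflectX p))) (f≗g (reflectY p))

module _ {f : Point → ℤ} (f-vanishes : VanishesBelow 0ℤ f) where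

  alternate-x≡-1 : ∀ y → alternate f (-1ℤ , y) ≡ 0ℤ
  alternate-x≡-1 y rewrite f-vanishes -1ℤ y (inj₁ -<+) | f-vanishes -1ℤ (- y - + 2) (inj₁ -<+) = refl

  alternate-y≡-1 : ∀ x → alternate f (x , -1ℤ) ≡ 0ℤ
  alternate-y≡-1 x rewrite f-vanishes x -1ℤ (inj₂ -<+) | f-vanishes (- x - + 2) -1ℤ (inj₂ -<+) = refl

  alternate-inQ : ∀ {a b} → + 0 ≤ a → + 0 ≤ b → alternate f (a , b) ≡ f (a , b)
  alternate-inQ {+ m} {+ n} (+≤+ _) (+≤+ _)
    rewrite f-vanishes (- (+ m) - + 2) (+ n) (inj₁ (<-1⇒<0 (reflect-<-1 m)))
          | f-vanishes (+ m) (- (+ n) - + 2) (inj₂ (<-1⇒<0 (reflect-<-1 n))) =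
      trans (ℤ.+-identityʳ _) (ℤ.+-identityʳ _)

  alternate-boundary : ∀ {a b} → a ≡ -1ℤ ⊎ b ≡ -1ℤ → alternate f (a , b) ≡ 0ℤ
  alternate-boundary {b = b} (inj₁ refl) = alternate-x≡-1 b
  alternate-boundary {a = a} (inj₂ refl) = alternate-y≡-1 a

  alternate-reflectX : ∀ {a b} → a < -1ℤ → alternate f (a , b) ≡ - f (reflectX (a , b))
  alternate-reflectX {a = -[1+ m ]} {b} (-<- _)
    rewrite f-vanishes -[1+ m ] b (inj₁ -<+) | f-vanishes -[1+ m ] (- b - + 2) (inj₁ -<+) =
      trans (ℤ.+-identityʳ _) (ℤ.+-identityˡ _)

  alternate-reflectY : ∀ {a b} → b < -1ℤ → alternate f (a , b) ≡ - f (reflectY (a , b))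
  alternate-reflectY {a} { -[1+ m ]} (-<- _)
    rewrite f-vanishes a -[1+ m ] (inj₂ -<+) | f-vanishes (- a - + 2) -[1+ m ] (inj₂ -<+) =
      ℤ.+-identityˡ _

forbidden-target : ∀ p q → forbidden p q ≡ true → q ≡ (0ℤ , -1ℤ) ⊎ q ≡ (-1ℤ , 0ℤ)
forbidden-target p q forbid with q == (0ℤ , -1ℤ) | ==-reflects q (0ℤ , -1ℤ)
... | true  | ofʸ q≡ = inj₁ q≡
... | false | ofⁿ _ with q == (-1ℤ , 0ℤ) | ==-reflects q (-1ℤ , 0ℤ)
...   | true  | ofʸ q≡ = inj₂ q≡
...   | false | ofⁿ _ rewrite ∧-zeroʳ (p == (-1ℤ , 0ℤ)) | ∧-zeroʳ (p == (0ℤ , -1ℤ)) with forbid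
...     | ()

guard-allowed-alternate : ∀ {f} → VanishesBelow 0ℤ f → ∀ p q →
  guard (not (forbidden p q)) (alternate f q) ≡ alternate f q
guard-allowed-alternate f-vanishes p q with forbidden p q in forbid
... | false = refl
... | true with forbidden-target p q forbid
...   | inj₁ refl = sym (alternate-y≡-1 f-vanishes 0ℤ)
...   | inj₂ refl = sym (alternate-x≡-1 f-vanishes 0ℤ)

neighbourSum-reflect : ∀ {L} (ρ ν : Point → Point) → (∀ p s → ρ (p ⊕ s) ≡ ρ p ⊕ ν s) → map ν L ↭ L →
  ∀ f p → ∑ L (λ s → f (ρ (p ⊕ s))) ≡ neighbourSum L f (ρ p)
neighbourSum-reflect {L} ρ ν ρ-⊕ νL↭L f p = begin
  ∑ L (λ s → f (ρ (p ⊕ s)))     ≡⟨ ∑-cong L (λ s → cong f (ρ-⊕ p s)) ⟩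
  ∑ L (λ s → f (ρ p ⊕ ν s))     ≡⟨ ∑-map ν L _ ⟨
  ∑ (map ν L) (λ s → f (ρ p ⊕ s)) ≡⟨ ∑-↭ _ νL↭L ⟩
  neighbourSum L f (ρ p)         ∎
  where open ≡-Reasoning

neighbourSum-alternate : ∀ {L} → AxisSymmetric L → ∀ f p →
  ∑ L (λ s → alternate f (p ⊕ s)) ≡ alternate (neighbourSum L f) p
neighbourSum-alternate {L} (negX-sym , negY-sym) f p = begin
  ∑ L (λ s → f (p ⊕ s) - f (reflectX (p ⊕ s)) - f (reflectY (p ⊕ s)))
    ≡⟨ ∑-- L _ _ ⟩
  ∑ L (λ s → f (p ⊕ s) - f (reflectX (p ⊕ s))) - ∑ L (λ s → f (reflectY (p ⊕ s)))
    ≡⟨ cong (_- ∑ L (λ s → f (reflectY (p ⊕ s)))) (∑-- L _ _) ⟩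
  neighbourSum L f p - ∑ L (λ s → f (reflectX (p ⊕ s))) - ∑ L (λ s → f (reflectY (p ⊕ s)))
    ≡⟨ cong₂ (λ u v → neighbourSum L f p - u - v)
             (neighbourSum-reflect reflectX negX reflectX-⊕ negX-sym f p)
             (neighbourSum-reflect reflectY negY reflectY-⊕ negY-sym f p) ⟩
  alternate (neighbourSum L f) p ∎
  where open ≡-Reasoning

-- On the line x = -1 (resp. y = -1) the reflection fixes p, so two terms of `alternate A p`
-- cancel; elsewhere the terms that survive are exactly those at points of Q.
guard-inC-alternate : ∀ {A} → VanishesBelow -1ℤ A → ∀ p →
  guard (inC p) (alternate A p) ≡ alternate (λ r → guard (inQ r) (A r)) p
guard-inC-alternate {A} A-vanishes (+ m , + n)
  rewrite A-vanishes (- (+ m) - + 2) (+ n) (inj₁ (reflect-<-1 m))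
        | A-vanishes (+ m) (- (+ n) - + 2) (inj₂ (reflect-<-1 n))
        | guard-zero (inQ (- (+ m) - + 2 , + n)) | guard-zero (inQ (+ m , - (+ n) - + 2)) = refl
guard-inC-alternate {A} A-vanishes (-[1+ 0 ] , + n)
  rewrite A-vanishes -1ℤ (- (+ n) - + 2) (inj₂ (reflect-<-1 n)) =
    trans (ℤ.+-identityʳ _) (ℤ.+-inverseʳ (A (-1ℤ , + n)))
guard-inC-alternate {A} A-vanishes (-[1+ suc k ] , + n)
  rewrite A-vanishes -[1+ suc k ] (+ n) (inj₁ (-<- (s≤s z≤n)))
        | A-vanishes -[1+ suc k ] (- (+ n) - + 2) (inj₁ (-<- (s≤s z≤n))) = refl
guard-inC-alternate {A} A-vanishes (+ m , -[1+ 0 ])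
  rewrite A-vanishes (- (+ m) - + 2) -1ℤ (inj₁ (reflect-<-1 m))
        | inQ-outside {x = - (+ m) - + 2} {y = -1ℤ} (inj₂ -<+) =
    trans (cong (_- A (+ m , -1ℤ)) (ℤ.+-identityʳ (A (+ m , -1ℤ)))) (ℤ.+-inverseʳ (A (+ m , -1ℤ)))
guard-inC-alternate {A} A-vanishes (+ m , -[1+ suc k ])
  rewrite A-vanishes (+ m) -[1+ suc k ] (inj₂ (-<- (s≤s z≤n)))
        | A-vanishes (- (+ m) - + 2) -[1+ suc k ] (inj₂ (-<- (s≤s z≤n)))
        | inQ-outside {x = - (+ m) - + 2} {y = -[1+ suc k ]} (inj₂ -<+) = refl
guard-inC-alternate {A} A-vanishes (-[1+ m ] , -[1+ n ])
  rewrite inQ-outside {x = - -[1+ m ] - + 2} {y = -[1+ n ]} (inj₂ -<+) = refl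

transferC-alternate : ∀ {L f} → AxisSymmetric L → All SmallStep L → VanishesBelow 0ℤ f →
  ∀ p → transferC L (alternate f) p ≡ alternate (transferQ L f) p
transferC-alternate {L} {f} symmetric small f-vanishes p = begin
  transferC L (alternate f) p
    ≡⟨ cong (guard (inC p)) (∑-cong L (λ s → guard-allowed-alternate f-vanishes p (p ⊕ s))) ⟩
  guard (inC p) (∑ L (λ s → alternate f (p ⊕ s)))
    ≡⟨ cong (guard (inC p)) (neighbourSum-alternate symmetric f p) ⟩
  guard (inC p) (alternate (neighbourSum L f) p)
    ≡⟨ guard-inC-alternate (neighbourSum-vanishesBelow small f-vanishes) p ⟩
  alternate (transferQ L f) p ∎
  where open ≡-Reasoning

walksC-reflection-zero : ∀ L i j p → let t = (+ i , + j) in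
  walksC L 0 p t ≡ walksC L 0 p (reflectX t) + walksC L 0 p (reflectY t) + alternate (λ r → walksQ L 0 r t) p
walksC-reflection-zero L i j p = begin
  walksC L 0 p t
    ≡⟨ walksC-zero L p t refl ⟩
  δ t
    ≡⟨ x≡y+z+[x-y-z] (δ t) (δ (reflectX t)) (δ (reflectY t)) ⟩
  δ (reflectX t) + δ (reflectY t) + (δ t - δ (reflectX t) - δ (reflectY t))
    ≡⟨ cong₂ _+_ (cong₂ _+_ (walksC-zero L p (reflectX t) (∨-zeroʳ _)) (walksC-zero L p (reflectY t) refl))
                 (cong₂ _-_ (cong₂ _-_ (walksQ-at p) (reflected reflectX reflectX-involutive))
                            (reflected reflectY reflectY-involutive)) ⟨
  walksC L 0 p (reflectX t) + walksC L 0 p (reflectY t) + alternate (λ r → walksQ L 0 r t) p ∎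
  where
  open ≡-Reasoning
  t : Point
  t = (+ i , + j)
  δ : Point → ℤ
  δ q = guard (p == q) 1ℤ
  x≡y+z+[x-y-z] : ∀ x y z → x ≡ y + z + (x - y - z)
  x≡y+z+[x-y-z] = solve-∀
  walksQ-at : ∀ r → walksQ L 0 r t ≡ guard (r == t) 1ℤ
  walksQ-at r = walksQ-zero L r t refl
  reflected : ∀ ρ → (∀ r → ρ (ρ r) ≡ r) → walksQ L 0 (ρ p) t ≡ δ (ρ t)
  reflected ρ ρ∘ρ≗id = trans (walksQ-at (ρ p)) (cong (λ b → guard b 1ℤ) (==-involution ρ ρ∘ρ≗id p t))

walksC-reflection : ∀ {L} → AxisSymmetric L → All SmallStep L → ∀ i j n p → let t = (+ i , + j) in
  walksC L n p t ≡ walksC L n p (reflectX t) + walksC L n p (reflectY t) + alternate (λ r → walksQ L n r t) p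
walksC-reflection {L} _         _     i j zero    p = walksC-reflection-zero L i j p
walksC-reflection {L} symmetric small i j (suc n) p = begin
  walksC L (suc n) p t
    ≡⟨ walksC-suc L n p t ⟩
  transferC L (λ r → walksC L n r t) p
    ≡⟨ transferC-cong L (walksC-reflection symmetric small i j n) p ⟩
  transferC L (λ r → C (reflectX t) r + C (reflectY t) r + H r) p
    ≡⟨ transferC-+ L (λ r → C (reflectX t) r + C (reflectY t) r) H p ⟩
  transferC L (λ r → C (reflectX t) r + C (reflectY t) r) p + transferC L H p
    ≡⟨ cong (_+ transferC L H p) (transferC-+ L (C (reflectX t)) (C (reflectY t)) p) ⟩
  transferC L (C (reflectX t)) p + transferC L (C (reflectY t)) p + transferC L H p
    ≡⟨ cong₂ _+_ (cong₂ _+_ (sym (walksC-suc L n p (reflectX t))) (sym (walksC-suc L n p (reflectY t))))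
                 (transferC-alternate symmetric small (walksQ-vanishesBelow L n t) p) ⟩
  walksC L (suc n) p (reflectX t) + walksC L (suc n) p (reflectY t) + alternate (transferQ L (λ r → walksQ L n r t)) p
    ≡⟨ cong (_+_ (walksC L (suc n) p (reflectX t) + walksC L (suc n) p (reflectY t)))
            (alternate-cong (λ r → sym (walksQ-suc L n r t)) p) ⟩
  walksC L (suc n) p (reflectX t) + walksC L (suc n) p (reflectY t) + alternate (λ r → walksQ L (suc n) r t) p ∎
  where
  open ≡-Reasoning
  t : Point
  t = (+ i , + j)
  C : Point → Point → ℤ
  C q r = walksC L n r q
  H : Point → ℤ
  H = alternate (λ r → walksQ L n r t)

axisSymmetric? : (L : List Point) → Maybe (AxisSymmetric L)
axisSymmetric? L = Maybe.zip (findPermutation _≟ₚ_ (map negX L) L) (findPermutation _≟ₚ_ (map negY L) L)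

steps-axisSymmetric : ∀ S → AxisSymmetric (steps S)
steps-axisSymmetric simple   = from-just (axisSymmetric? (steps simple))
steps-axisSymmetric diagonal = from-just (axisSymmetric? (steps diagonal))
steps-axisSymmetric king     = from-just (axisSymmetric? (steps king))
steps-axisSymmetric diabolo  = from-just (axisSymmetric? (steps diabolo))

smallStep? : ∀ s → Dec (SmallStep s)
smallStep? (a , b) = (a ℤ.≤? 1ℤ) ×-dec (b ℤ.≤? 1ℤ)

steps-small : ∀ S → All SmallStep (steps S)
steps-small simple   = from-yes (All.all? smallStep? (steps simple))
steps-small diagonal = from-yes (All.all? smallStep? (steps diagonal))
steps-small king     = from-yes (All.all? smallStep? (steps king))
steps-small diabolo  = from-yes (All.all? smallStep? (steps diabolo))

proposition11 : (S : StepSet) (a b : ℤ) → (+ 0 ≤ a ⊎ + 0 ≤ b) → (i j : ℕ) → (n : ℕ) →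
  let C : ℤ → ℤ → ℤ
      C x y = + Ccoeff S n a b x y
      Q : ℤ → ℤ → ℤ
      Q x y = + Qcoeff S n x y (+ i) (+ j)
      base : ℤ
      base = C (- (+ i) - + 2) (+ j) + C (+ i) (- (+ j) - + 2)
  in ((+ 0 ≤ a × + 0 ≤ b) → C (+ i) (+ j) ≡ base + Q a b)
   × ((a ≡ - (+ 1) ⊎ b ≡ - (+ 1)) → C (+ i) (+ j) ≡ base)
   × (a < - (+ 1) → C (+ i) (+ j) ≡ base - Q (- a - + 2) b)
   × (b < - (+ 1) → C (+ i) (+ j) ≡ base - Q a (- b - + 2))
-- The identity holds for every start point.
proposition11 S a b _ i j n =
  (λ (0≤a , 0≤b) → trans identity (cong (_+_ base) (alternate-inQ Q-vanishes 0≤a 0≤b))) ,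
  (λ on-boundary → trans identity (trans (cong (_+_ base) (alternate-boundary Q-vanishes on-boundary))
                                        (ℤ.+-identityʳ base))) ,
  (λ a<-1 → trans identity (cong (_+_ base) (alternate-reflectX Q-vanishes a<-1))) ,
  (λ b<-1 → trans identity (cong (_+_ base) (alternate-reflectY Q-vanishes b<-1)))
  where
  L : List Point
  L = steps S
  t : Point
  t = (+ i , + j)
  base : ℤ
  base = walksC L n (a , b) (reflectX t) + walksC L n (a , b) (reflectY t)
  identity : walksC L n (a , b) t ≡ base + alternate (λ r → walksQ L n r t) (a , b)
  identity = walksC-reflection (steps-axisSymmetric S) (steps-small S) i j n (a , b)
  Q-vanishes : VanishesBelow 0ℤ (λ r → walksQ L n r t)
  Q-vanishes = walksQ-vanishesBelow L n t
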